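{- For every integer $n\ge0$ and every $w\in\mathfrak{h}$, \[ \sum_{j=0}^{n}f_j(yx^{n-j}w)=yf_n(w). \]
   Context: Let $\mathfrak{h}=\mathbb{Q}\langle x,y\rangle$ and $z=x+y$. The harmonic product $*$ on $\mathfrak{h}$ is the bilinear map with $1*w=w*1=w$, $xw_1*w_2=w_1*xw_2=x(w_1*w_2)$ and $yw_1*yw_2=y(w_1*yw_2)+y(yw_1*w_2)+yx(w_1*w_2)$. Let $\varphi$ be the algebra automorphism of $\mathfrak{h}$ with $\varphi(x)=z$, $\varphi(y)=-y$, and $w_1\diamond w_2=\varphi(\varphi(w_1)*\varphi(w_2))$. For $n\in\mathbb{Z}$ define $f_n(w)=0$ if $n<0$, $f_0(w)=w$, and $f_n(w)=y^n\diamond w-(y^{n-1}\diamond w)y$ if $n\ge1$. -}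

module Defs where

open import Data.Nat using (ℕ; zero; suc; _∸_)
open import Data.Bool using (Bool; true; false; _∧_; if_then_else_)
open import Data.Rational using (ℚ; 0ℚ; 1ℚ; -_) renaming (_+_ to _+ℚ_; _*_ to _*ℚ_)
open import Data.List using (List; []; _∷_; _++_; map; concatMap; replicate)
open import Data.Product using (_×_; _,_)
open import Relation.Binary.PropositionalEquality using (_≡_)

-- Letters of the alphabet {x, y}; words = monomials of 𝔥 = ℚ⟨x,y⟩.
data Letter : Set where
  x y : Letter

Word : Set
Word = List Letter

eqL : Letter → Letter → Bool
eqL x x = true
eqL y y = true
eqL _ _ = false

eqW : Word → Word → Bool
eqW [] [] = true
eqW (a ∷ u) (b ∷ v) = eqL a b ∧ eqW u v
eqW _ _ = false

-- An element of 𝔥 is represented by a finite formal linear combination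
-- of words (list of (coefficient, word) terms, repetitions allowed).
H : Set
H = List (ℚ × Word)

coeff : H → Word → ℚ
coeff [] u = 0ℚ
coeff ((c , v) ∷ p) u = (if eqW v u then c else 0ℚ) +ℚ coeff p u

infix 4 _≈_
_≈_ : H → H → Set
p ≈ q = ∀ (u : Word) → coeff p u ≡ coeff q u

word : Word → H
word u = (1ℚ , u) ∷ []

𝟎 : H
𝟎 = []

infixl 6 _⊕_ _⊖_
_⊕_ : H → H → H
p ⊕ q = p ++ q

scale : ℚ → H → H
scale c = map (λ { (d , v) → (c *ℚ d , v) })

_⊖_ : H → H → H
p ⊖ q = p ++ scale (- 1ℚ) q

infixl 7 _·_
_·_ : H → H → H
p · q = concatMap (λ { (c , u) → map (λ { (d , v) → (c *ℚ d , u ++ v) }) q }) p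

lmul : Word → H → H
lmul u p = word u · p

hw : Word → Word → H
hw [] v = word v
hw (x ∷ u) v = lmul (x ∷ []) (hw u v)
hw (y ∷ u) [] = word (y ∷ u)
hw (y ∷ u) (x ∷ v) = lmul (x ∷ []) (hw (y ∷ u) v)
hw (y ∷ u) (y ∷ v) =
  lmul (y ∷ []) (hw u (y ∷ v)) ⊕ lmul (y ∷ []) (hw (y ∷ u) v) ⊕ lmul (y ∷ x ∷ []) (hw u v)

infixl 7 _*_
_*_ : H → H → H
p * q = concatMap (λ { (c , u) → concatMap (λ { (d , v) → scale (c *ℚ d) (hw u v) }) q }) p

φL : Letter → H
φL x = word (x ∷ []) ⊕ word (y ∷ [])
φL y = scale (- 1ℚ) (word (y ∷ []))

φW : Word → H
φW [] = word []
φW (a ∷ u) = φL a · φW u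

φ : H → H
φ p = concatMap (λ { (c , u) → scale c (φW u) }) p

infixl 7 _◇_
_◇_ : H → H → H
p ◇ q = φ (φ p * φ q)

yⁿ : ℕ → H
yⁿ n = word (replicate n y)

xⁿ : ℕ → H
xⁿ n = word (replicate n x)

-- f_n for n ≥ 0 (f_n = 0 for n < 0 is never needed below).
f : ℕ → H → H
f zero w = w
f (suc n) w = (yⁿ (suc n) ◇ w) ⊖ ((yⁿ n ◇ w) · word (y ∷ []))

sumTo : ℕ → (ℕ → H) → H
sumTo zero g = g zero
sumTo (suc n) g = sumTo n g ⊕ g (suc n)

yH : H
yH = word (y ∷ [])

module Submission where

-- Since φ is an involution with
-- φ(y u) = −y φ(u) and φ(x u) = (x + y) φ(u), the recursion of * on two y-words transports to
-- (y u) ◇ (y w) = y ((y u) ◇ w) − y (u ◇ x w) for all u, w; with u = yⁿ this gives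
-- f_{n+1}(y w) = y f_{n+1}(w) − y fₙ(x w).  The sum for n + 1 is the sum for n evaluated at x w
-- plus the new term f_{n+1}(y w), so the theorem follows by induction on n.
--
-- On the list representation every operation is the linear extension of a map on words; all of
-- them respect ≈ because a linear functional vanishes on any list whose coefficients are all zero.

open import Defs
open import Data.Nat using (ℕ; zero; suc; _+_; _∸_; _≤_; z≤n; s≤s)
open import Data.Nat.Properties using (≤-trans; ≤-refl; m≤n⇒m≤1+n; n∸n≡0; +-∸-assoc)
open import Data.Bool using (true; false; if_then_else_)
open import Data.Rational using (ℚ; 0ℚ; 1ℚ; -_) renaming (_+_ to _+ℚ_; _*_ to _*ℚ_)
import Data.Rational.Properties as ℚ
open import Data.Rational.Solver using (module +-*-Solver)
open import Data.List using ([]; _∷_; _++_; replicate; length)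
import Data.List.Properties as List
open import Data.Product using (_,_)
open import Level using (0ℓ)
open import Relation.Binary.Bundles using (Setoid)
open import Relation.Binary.PropositionalEquality
  using (_≡_; refl; sym; trans; cong; cong₂; module ≡-Reasoning)
import Relation.Binary.Reasoning.Setoid as SetoidReasoning

open +-*-Solver using (solve; _:+_; _:-_; _:*_; :-_; con; _:=_)

-1ℚ : ℚ
-1ℚ = - 1ℚ

xH : H
xH = word (x ∷ [])

eqL-refl : ∀ a → eqL a a ≡ true
eqL-refl x = refl
eqL-refl y = refl

eqW-refl : ∀ u → eqW u u ≡ true
eqW-refl [] = refl
eqW-refl (a ∷ u) rewrite eqL-refl a = eqW-refl u

eqW⇒≡ : ∀ u v → eqW u v ≡ true → u ≡ v
eqW⇒≡ [] [] _ = refl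
eqW⇒≡ (x ∷ u) (x ∷ v) e = cong (x ∷_) (eqW⇒≡ u v e)
eqW⇒≡ (y ∷ u) (y ∷ v) e = cong (y ∷_) (eqW⇒≡ u v e)
eqW⇒≡ [] (_ ∷ _) ()
eqW⇒≡ (_ ∷ _) [] ()
eqW⇒≡ (x ∷ u) (y ∷ v) ()
eqW⇒≡ (y ∷ u) (x ∷ v) ()

coeff-++ : ∀ p q u → coeff (p ++ q) u ≡ coeff p u +ℚ coeff q u
coeff-++ [] q u = sym (ℚ.+-identityˡ _)
coeff-++ ((c , v) ∷ p) q u =
  trans (cong (cᵥ +ℚ_) (coeff-++ p q u)) (sym (ℚ.+-assoc cᵥ (coeff p u) (coeff q u)))
  where cᵥ = if eqW v u then c else 0ℚ

coeff-scale : ∀ c p u → coeff (scale c p) u ≡ c *ℚ coeff p u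
coeff-scale c [] u = sym (ℚ.*-zeroʳ c)
coeff-scale c ((d , v) ∷ p) u =
  trans (cong₂ _+ℚ_ (if-* (eqW v u)) (coeff-scale c p u)) (sym (ℚ.*-distribˡ-+ c _ _))
  where
  if-* : ∀ b → (if b then c *ℚ d else 0ℚ) ≡ c *ℚ (if b then d else 0ℚ)
  if-* true = refl
  if-* false = sym (ℚ.*-zeroʳ c)

-- A record rather than _≈_ itself, so that both sides can be inferred from a proof.
infix 4 _≋_
record _≋_ (p q : H) : Set where
  constructor ≈⇒≋
  field ≋⇒≈ : p ≈ q
open _≋_ public

≋-refl : ∀ {p} → p ≋ p
≋-refl = ≈⇒≋ λ _ → refl

≋-sym : ∀ {p q} → p ≋ q → q ≋ p
≋-sym e = ≈⇒≋ λ u → sym (≋⇒≈ e u)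

≋-trans : ∀ {p q r} → p ≋ q → q ≋ r → p ≋ r
≋-trans e e' = ≈⇒≋ λ u → trans (≋⇒≈ e u) (≋⇒≈ e' u)

≋-setoid : Setoid 0ℓ 0ℓ
≋-setoid = record
  { Carrier = H
  ; _≈_ = _≋_
  ; isEquivalence = record { refl = ≋-refl ; sym = ≋-sym ; trans = ≋-trans }
  }

module ≋-Reasoning = SetoidReasoning ≋-setoid

≡⇒≋ : ∀ {p q} → p ≡ q → p ≋ q
≡⇒≋ refl = ≋-refl

⊕-cong : ∀ {p p' q q'} → p ≋ p' → q ≋ q' → p ⊕ q ≋ p' ⊕ q'
⊕-cong {p} {p'} {q} {q'} e e' = ≈⇒≋ λ u →
  trans (coeff-++ p q u) (trans (cong₂ _+ℚ_ (≋⇒≈ e u) (≋⇒≈ e' u)) (sym (coeff-++ p' q' u)))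

scale-cong : ∀ c {p q} → p ≋ q → scale c p ≋ scale c q
scale-cong c {p} {q} e = ≈⇒≋ λ u →
  trans (coeff-scale c p u) (trans (cong (c *ℚ_) (≋⇒≈ e u)) (sym (coeff-scale c q u)))

⊖-cong : ∀ {p p' q q'} → p ≋ p' → q ≋ q' → p ⊖ q ≋ p' ⊖ q'
⊖-cong e e' = ⊕-cong e (scale-cong -1ℚ e')

⊕-congˡ : ∀ p {q q'} → q ≋ q' → p ⊕ q ≋ p ⊕ q'
⊕-congˡ p = ⊕-cong (≋-refl {p})

⊖-congˡ : ∀ p {q q'} → q ≋ q' → p ⊖ q ≋ p ⊖ q'
⊖-congˡ p = ⊖-cong (≋-refl {p})

scale-++ : ∀ c p q → scale c (p ++ q) ≡ scale c p ++ scale c q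
scale-++ c = List.map-++ _

scale-scale : ∀ c d p → scale c (scale d p) ≋ scale (c *ℚ d) p
scale-scale c d p = ≈⇒≋ λ u →
  trans (coeff-scale c (scale d p) u) (trans (cong (c *ℚ_) (coeff-scale d p u))
  (trans (sym (ℚ.*-assoc c d (coeff p u))) (sym (coeff-scale (c *ℚ d) p u))))

-- Identities between linear combinations, checked coefficientwise by the ring solver on ℚ.
infixl 6 _⊞_ _⊟_
data LinExpr : Set where
  atom : H → LinExpr
  _⊞_ _⊟_ : LinExpr → LinExpr → LinExpr
  negᴱ : LinExpr → LinExpr

⟦_⟧ : LinExpr → H
⟦ atom p ⟧ = p
⟦ a ⊞ b ⟧ = ⟦ a ⟧ ⊕ ⟦ b ⟧
⟦ a ⊟ b ⟧ = ⟦ a ⟧ ⊖ ⟦ b ⟧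
⟦ negᴱ a ⟧ = scale -1ℚ ⟦ a ⟧

coeffᴱ : LinExpr → Word → ℚ
coeffᴱ (atom p) u = coeff p u
coeffᴱ (a ⊞ b) u = coeffᴱ a u +ℚ coeffᴱ b u
coeffᴱ (a ⊟ b) u = coeffᴱ a u +ℚ - coeffᴱ b u
coeffᴱ (negᴱ a) u = - coeffᴱ a u

coeff-neg : ∀ e u → coeff (scale -1ℚ ⟦ e ⟧) u ≡ - coeffᴱ e u

coeff-⟦⟧ : ∀ e u → coeff ⟦ e ⟧ u ≡ coeffᴱ e u
coeff-⟦⟧ (atom p) u = refl
coeff-⟦⟧ (a ⊞ b) u = trans (coeff-++ ⟦ a ⟧ ⟦ b ⟧ u) (cong₂ _+ℚ_ (coeff-⟦⟧ a u) (coeff-⟦⟧ b u))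
coeff-⟦⟧ (a ⊟ b) u = trans (coeff-++ ⟦ a ⟧ _ u) (cong₂ _+ℚ_ (coeff-⟦⟧ a u) (coeff-neg b u))
coeff-⟦⟧ (negᴱ a) u = coeff-neg a u

coeff-neg e u = trans (coeff-scale -1ℚ ⟦ e ⟧ u) (trans (cong (-1ℚ *ℚ_) (coeff-⟦⟧ e u))
  (solve 1 (λ t → (:- con 1ℚ) :* t := :- t) refl (coeffᴱ e u)))

coeffᴱ-≋ : ∀ e e' → (∀ u → coeffᴱ e u ≡ coeffᴱ e' u) → ⟦ e ⟧ ≋ ⟦ e' ⟧
coeffᴱ-≋ e e' h = ≈⇒≋ λ u → trans (coeff-⟦⟧ e u) (trans (h u) (sym (coeff-⟦⟧ e' u)))

linear : (Word → ℚ) → H → ℚ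
linear F [] = 0ℚ
linear F ((c , u) ∷ p) = c *ℚ F u +ℚ linear F p

linear-++ : ∀ F p q → linear F (p ++ q) ≡ linear F p +ℚ linear F q
linear-++ F [] q = sym (ℚ.+-identityˡ _)
linear-++ F ((c , u) ∷ p) q =
  trans (cong (c *ℚ F u +ℚ_) (linear-++ F p q)) (sym (ℚ.+-assoc (c *ℚ F u) (linear F p) (linear F q)))

linear-scale : ∀ F c p → linear F (scale c p) ≡ c *ℚ linear F p
linear-scale F c [] = sym (ℚ.*-zeroʳ c)
linear-scale F c ((d , u) ∷ p) =
  trans (cong ((c *ℚ d) *ℚ F u +ℚ_) (linear-scale F c p))
        (solve 4 (λ c d f l → (c :* d) :* f :+ c :* l := c :* (d :* f :+ l)) refl c d (F u) (linear F p))

linear-pointwise : ∀ {F G} p → (∀ u → F u ≡ G u) → linear F p ≡ linear G p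
linear-pointwise [] h = refl
linear-pointwise ((c , u) ∷ p) h = cong₂ _+ℚ_ (cong (c *ℚ_) (h u)) (linear-pointwise p h)

linear-+ᶠ : ∀ F G p → linear (λ u → F u +ℚ G u) p ≡ linear F p +ℚ linear G p
linear-+ᶠ F G [] = sym (ℚ.+-identityˡ 0ℚ)
linear-+ᶠ F G ((c , u) ∷ p) = trans (cong (c *ℚ (F u +ℚ G u) +ℚ_) (linear-+ᶠ F G p))
  (solve 5 (λ c f g a b → c :* (f :+ g) :+ (a :+ b) := (c :* f :+ a) :+ (c :* g :+ b))
         refl c (F u) (G u) (linear F p) (linear G p))

linear-*ᶠ : ∀ F c p → linear (λ u → c *ℚ F u) p ≡ c *ℚ linear F p
linear-*ᶠ F c [] = sym (ℚ.*-zeroʳ c)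
linear-*ᶠ F c ((d , u) ∷ p) = trans (cong (d *ℚ (c *ℚ F u) +ℚ_) (linear-*ᶠ F c p))
  (solve 4 (λ d c f l → d :* (c :* f) :+ c :* l := c :* (d :* f :+ l)) refl d c (F u) (linear F p))

dropWord : Word → H → H
dropWord u [] = []
dropWord u ((d , v) ∷ r) = if eqW v u then dropWord u r else (d , v) ∷ dropWord u r

length-dropWord : ∀ u r → length (dropWord u r) ≤ length r
length-dropWord u [] = z≤n
length-dropWord u ((d , v) ∷ r) with eqW v u
... | true = m≤n⇒m≤1+n (length-dropWord u r)
... | false = s≤s (length-dropWord u r)

linear-dropWord : ∀ F u r → linear F r ≡ coeff r u *ℚ F u +ℚ linear F (dropWord u r)
linear-dropWord F u [] = solve 1 (λ f → con 0ℚ := con 0ℚ :* f :+ con 0ℚ) refl (F u)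
linear-dropWord F u ((d , v) ∷ r) with eqW v u in v≡u
... | true rewrite eqW⇒≡ v u v≡u =
  trans (cong (d *ℚ F u +ℚ_) (linear-dropWord F u r))
    (solve 4 (λ d f c l → d :* f :+ (c :* f :+ l) := (d :+ c) :* f :+ l)
           refl d (F u) (coeff r u) (linear F (dropWord u r)))
... | false =
  trans (cong (d *ℚ F v +ℚ_) (linear-dropWord F u r))
    (solve 5 (λ d f c l g → d :* g :+ (c :* f :+ l) := (con 0ℚ :+ c) :* f :+ (d :* g :+ l))
           refl d (F u) (coeff r u) (linear F (dropWord u r)) (F v))

coeff-dropWord : ∀ u r w → coeff (dropWord u r) w ≡ (if eqW u w then 0ℚ else coeff r w)
coeff-dropWord u [] w with eqW u w
... | true = refl
... | false = refl
coeff-dropWord u ((d , v) ∷ r) w with eqW v u in v≡u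
... | true rewrite eqW⇒≡ v u v≡u = trans (coeff-dropWord u r w) (drop-head (eqW u w))
  where
  drop-head : ∀ b → (if b then 0ℚ else coeff r w)
                   ≡ (if b then 0ℚ else (if b then d else 0ℚ) +ℚ coeff r w)
  drop-head true = refl
  drop-head false = sym (ℚ.+-identityˡ _)
... | false with eqW u w in u≡w
...   | true rewrite sym (eqW⇒≡ u w u≡w) | v≡u =
  trans (cong (0ℚ +ℚ_) (trans (coeff-dropWord u r u)
                                (cong (λ b → if b then 0ℚ else coeff r u) (eqW-refl u))))
        (ℚ.+-identityˡ 0ℚ)
...   | false = cong ((if eqW v w then d else 0ℚ) +ℚ_)
                  (trans (coeff-dropWord u r w) (cong (λ b → if b then 0ℚ else coeff r w) u≡w))

-- Gather all terms on the head word u with dropWord: their total coefficient is zero, and the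
-- remaining list is shorter.
linear-vanishes : ∀ F r → (∀ u → coeff r u ≡ 0ℚ) → linear F r ≡ 0ℚ
linear-vanishes F r = vanishes (length r) r ≤-refl
  where
  vanishes : ∀ n r → length r ≤ n → (∀ u → coeff r u ≡ 0ℚ) → linear F r ≡ 0ℚ
  vanishes n [] _ _ = refl
  vanishes (suc n) ((c , u) ∷ r) (s≤s l) h =
    begin
      c *ℚ F u +ℚ linear F r
    ≡⟨ cong (c *ℚ F u +ℚ_) (linear-dropWord F u r) ⟩
      c *ℚ F u +ℚ (coeff r u *ℚ F u +ℚ linear F (dropWord u r))
    ≡⟨ cong (λ t → c *ℚ F u +ℚ (coeff r u *ℚ F u +ℚ t)) rest-vanishes ⟩
      c *ℚ F u +ℚ (coeff r u *ℚ F u +ℚ 0ℚ)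
    ≡⟨ solve 3 (λ c f k → c :* f :+ (k :* f :+ con 0ℚ) := (c :+ k) :* f) refl c (F u) (coeff r u) ⟩
      (c +ℚ coeff r u) *ℚ F u
    ≡⟨ cong (_*ℚ F u) coeff-u ⟩
      0ℚ *ℚ F u
    ≡⟨ ℚ.*-zeroˡ (F u) ⟩
      0ℚ
    ∎
    where
    open ≡-Reasoning
    coeff-u : c +ℚ coeff r u ≡ 0ℚ
    coeff-u = trans (cong (λ b → (if b then c else 0ℚ) +ℚ coeff r u) (sym (eqW-refl u))) (h u)
    rest-zero : ∀ w → coeff (dropWord u r) w ≡ 0ℚ
    rest-zero w with eqW u w in u≡w | coeff-dropWord u r w
    ... | true | cr = cr
    ... | false | cr = trans cr (trans (sym (ℚ.+-identityˡ _))
            (trans (cong (λ b → (if b then c else 0ℚ) +ℚ coeff r w) (sym u≡w)) (h w)))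
    rest-vanishes : linear F (dropWord u r) ≡ 0ℚ
    rest-vanishes = vanishes n (dropWord u r) (≤-trans (length-dropWord u r) l) rest-zero

linear-cong : ∀ F {p q} → p ≋ q → linear F p ≡ linear F q
linear-cong F {p} {q} e =
  begin
    linear F p
  ≡⟨ solve 2 (λ a b → a := (a :+ (:- con 1ℚ) :* b) :+ b) refl (linear F p) (linear F q) ⟩
    (linear F p +ℚ -1ℚ *ℚ linear F q) +ℚ linear F q
  ≡⟨ cong (_+ℚ linear F q) difference-vanishes ⟩
    0ℚ +ℚ linear F q
  ≡⟨ ℚ.+-identityˡ _ ⟩
    linear F q
  ∎
  where
  open ≡-Reasoning
  coeff-difference : ∀ u → coeff (p ⊖ q) u ≡ 0ℚ
  coeff-difference u = trans (coeff-⟦⟧ (atom p ⊟ atom q) u)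
    (trans (cong (λ t → t +ℚ - coeff q u) (≋⇒≈ e u)) (ℚ.+-inverseʳ (coeff q u)))
  difference-vanishes : linear F p +ℚ -1ℚ *ℚ linear F q ≡ 0ℚ
  difference-vanishes = trans (sym (trans (linear-++ F p _) (cong (linear F p +ℚ_) (linear-scale F -1ℚ q))))
                              (linear-vanishes F (p ⊖ q) coeff-difference)

extend : (Word → H) → H → H
extend g [] = []
extend g ((c , u) ∷ p) = scale c (g u) ++ extend g p

coeff-extend : ∀ g p v → coeff (extend g p) v ≡ linear (λ u → coeff (g u) v) p
coeff-extend g [] v = refl
coeff-extend g ((c , u) ∷ p) v =
  trans (coeff-++ (scale c (g u)) (extend g p) v) (cong₂ _+ℚ_ (coeff-scale c (g u) v) (coeff-extend g p v))

extend-cong : ∀ g {p q} → p ≋ q → extend g p ≋ extend g q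
extend-cong g {p} {q} e = ≈⇒≋ λ v →
  trans (coeff-extend g p v) (trans (linear-cong _ e) (sym (coeff-extend g q v)))

extend-pointwise : ∀ {g g'} p → (∀ u → g u ≋ g' u) → extend g p ≋ extend g' p
extend-pointwise {g} {g'} p h = ≈⇒≋ λ v →
  trans (coeff-extend g p v) (trans (linear-pointwise p (λ u → ≋⇒≈ (h u) v)) (sym (coeff-extend g' p v)))

extend-++ : ∀ g p q → extend g (p ++ q) ≡ extend g p ++ extend g q
extend-++ g [] q = refl
extend-++ g ((c , u) ∷ p) q =
  trans (cong (scale c (g u) ++_) (extend-++ g p q)) (sym (List.++-assoc (scale c (g u)) _ _))

extend-scale : ∀ g c p → extend g (scale c p) ≋ scale c (extend g p)
extend-scale g c p = ≈⇒≋ λ v → trans (coeff-extend g (scale c p) v) (trans (linear-scale _ c p)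
  (trans (cong (c *ℚ_) (sym (coeff-extend g p v))) (sym (coeff-scale c (extend g p) v))))

extend-word : ∀ g u → extend g (word u) ≋ g u
extend-word g u = ≈⇒≋ λ v → trans (coeff-extend g (word u) v)
  (solve 1 (λ a → con 1ℚ :* a :+ con 0ℚ := a) refl (coeff (g u) v))

extend-⊕ᶠ : ∀ g h p → extend (λ u → g u ⊕ h u) p ≋ extend g p ⊕ extend h p
extend-⊕ᶠ g h p = ≈⇒≋ λ v →
  trans (coeff-extend _ p v) (trans (linear-pointwise p (λ u → coeff-++ (g u) (h u) v))
  (trans (linear-+ᶠ _ _ p) (trans (cong₂ _+ℚ_ (sym (coeff-extend g p v)) (sym (coeff-extend h p v)))
  (sym (coeff-++ (extend g p) (extend h p) v)))))

extend-scaleᶠ : ∀ g c p → extend (λ u → scale c (g u)) p ≋ scale c (extend g p)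
extend-scaleᶠ g c p = ≈⇒≋ λ v →
  trans (coeff-extend _ p v) (trans (linear-pointwise p (λ u → coeff-scale c (g u) v))
  (trans (linear-*ᶠ _ c p) (trans (cong (c *ℚ_) (sym (coeff-extend g p v)))
  (sym (coeff-scale c (extend g p) v)))))

extend-extend : ∀ g h p → extend g (extend h p) ≋ extend (λ u → extend g (h u)) p
extend-extend g h [] = ≋-refl
extend-extend g h ((c , u) ∷ p) =
  ≋-trans (≡⇒≋ (extend-++ g (scale c (h u)) (extend h p)))
          (⊕-cong (extend-scale g c (h u)) (extend-extend g h p))

extend-unit : ∀ p → extend word p ≋ p
extend-unit p = ≈⇒≋ λ v → trans (coeff-extend word p v) (linear-indicator v p)
  where
  linear-indicator : ∀ v p → linear (λ u → coeff (word u) v) p ≡ coeff p v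
  linear-indicator v [] = refl
  linear-indicator v ((c , u) ∷ p) with eqW u v
  ... | true = cong₂ _+ℚ_ (solve 1 (λ c → c :* (con 1ℚ :+ con 0ℚ) := c) refl c) (linear-indicator v p)
  ... | false = cong₂ _+ℚ_ (solve 1 (λ c → c :* (con 0ℚ :+ con 0ℚ) := con 0ℚ) refl c) (linear-indicator v p)

extend-zero : ∀ p → extend (λ _ → []) p ≡ []
extend-zero [] = refl
extend-zero ((c , u) ∷ p) = extend-zero p

prefix : Word → H → H
prefix u = extend (λ v → word (u ++ v))

·-singleton : ∀ c u q → ((c , u) ∷ []) · q ≋ scale c (prefix u q)
·-singleton c u [] = ≋-refl
·-singleton c u ((d , v) ∷ q) =
  ≋-trans (⊕-cong (≡⇒≋ (cong (λ t → (c *ℚ t , u ++ v) ∷ []) (sym (ℚ.*-identityʳ d))))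
                  (·-singleton c u q))
          (≡⇒≋ (sym (scale-++ c (scale d (word (u ++ v))) (prefix u q))))

·-as-extend : ∀ p q → p · q ≋ extend (λ u → prefix u q) p
·-as-extend [] q = ≋-refl
·-as-extend ((c , u) ∷ p) q =
  ≋-trans (≡⇒≋ (cong (_++ (p · q)) (sym (List.++-identityʳ _))))
          (⊕-cong (·-singleton c u q) (·-as-extend p q))

·-congʳ : ∀ {p p'} q → p ≋ p' → p · q ≋ p' · q
·-congʳ {p} {p'} q e = ≋-trans (·-as-extend p q) (≋-trans (extend-cong _ e) (≋-sym (·-as-extend p' q)))

·-congˡ : ∀ p {q q'} → q ≋ q' → p · q ≋ p · q'
·-congˡ p {q} {q'} e =
  ≋-trans (·-as-extend p q)
          (≋-trans (extend-pointwise p (λ u → extend-cong _ e)) (≋-sym (·-as-extend p q')))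

·-distribʳ-⊕ : ∀ p q r → (p ⊕ q) · r ≋ p · r ⊕ q · r
·-distribʳ-⊕ p q r = ≋-trans (·-as-extend (p ⊕ q) r) (≋-trans (≡⇒≋ (extend-++ _ p q))
  (⊕-cong (≋-sym (·-as-extend p r)) (≋-sym (·-as-extend q r))))

·-distribˡ-⊕ : ∀ p q r → p · (q ⊕ r) ≋ p · q ⊕ p · r
·-distribˡ-⊕ p q r = ≋-trans (·-as-extend p (q ⊕ r))
  (≋-trans (extend-pointwise p (λ u → ≡⇒≋ (extend-++ _ q r)))
  (≋-trans (extend-⊕ᶠ (λ u → prefix u q) (λ u → prefix u r) p)
  (⊕-cong (≋-sym (·-as-extend p q)) (≋-sym (·-as-extend p r)))))

·-scaleˡ : ∀ c p q → scale c p · q ≋ scale c (p · q)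
·-scaleˡ c p q =
  ≋-trans (·-as-extend (scale c p) q) (≋-trans (extend-scale _ c p) (scale-cong c (≋-sym (·-as-extend p q))))

·-scaleʳ : ∀ c p q → p · scale c q ≋ scale c (p · q)
·-scaleʳ c p q = ≋-trans (·-as-extend p (scale c q)) (≋-trans (extend-pointwise p (λ u → extend-scale _ c q))
  (≋-trans (extend-scaleᶠ (λ u → prefix u q) c p) (scale-cong c (≋-sym (·-as-extend p q)))))

·-distribˡ-⊖ : ∀ r p q → r · (p ⊖ q) ≋ r · p ⊖ r · q
·-distribˡ-⊖ r p q = ≋-trans (·-distribˡ-⊕ r p (scale -1ℚ q)) (⊕-congˡ (r · p) (·-scaleʳ -1ℚ r q))

·-distribʳ-⊖ : ∀ p q r → (p ⊖ q) · r ≋ p · r ⊖ q · r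
·-distribʳ-⊖ p q r = ≋-trans (·-distribʳ-⊕ p (scale -1ℚ q) r) (⊕-congˡ (p · r) (·-scaleˡ -1ℚ q r))

word·-as-prefix : ∀ u p → word u · p ≋ prefix u p
word·-as-prefix u p = ≋-trans (·-as-extend (word u) p) (extend-word (λ w → prefix w p) u)

word-++ : ∀ u v → word (u ++ v) ≋ word u · word v
word-++ u v = ≡⇒≋ (cong (λ t → (t , u ++ v) ∷ []) (sym (ℚ.*-identityˡ 1ℚ)))

·-assoc : ∀ p q r → (p · q) · r ≋ p · (q · r)
·-assoc p q r = ≋-trans left (≋-sym right)
  where
  G : Word → H
  G u = extend (λ v → extend (λ t → word (u ++ (v ++ t))) r) q
  left : (p · q) · r ≋ extend G p
  left = ≋-trans (·-as-extend (p · q) r)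
    (≋-trans (extend-cong (λ t → prefix t r) (·-as-extend p q))
    (≋-trans (extend-extend (λ t → prefix t r) (λ u → prefix u q) p)
    (extend-pointwise p (λ u → ≋-trans (extend-extend _ _ q) (extend-pointwise q (λ v →
      ≋-trans (extend-word (λ t → prefix t r) (u ++ v))
              (extend-pointwise r (λ t → ≡⇒≋ (cong word (List.++-assoc u v t))))))))))
  right : p · (q · r) ≋ extend G p
  right = ≋-trans (·-as-extend p (q · r))
    (extend-pointwise p (λ u → ≋-trans (extend-cong (λ s → word (u ++ s)) (·-as-extend q r))
    (≋-trans (extend-extend _ _ q)
    (extend-pointwise q (λ v → ≋-trans (extend-extend _ _ r)
    (extend-pointwise r (λ t → extend-word (λ s → word (u ++ s)) (v ++ t))))))))

·-extend : ∀ r g q → r · extend g q ≋ extend (λ v → r · g v) q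
·-extend r g [] = ≋-trans (·-as-extend r []) (≡⇒≋ (extend-zero r))
·-extend r g ((c , v) ∷ q) =
  ≋-trans (·-distribˡ-⊕ r (scale c (g v)) (extend g q)) (⊕-cong (·-scaleʳ c r (g v)) (·-extend r g q))

·-identityʳ : ∀ p → p · word [] ≋ p
·-identityʳ p = ≋-trans (·-as-extend p (word []))
  (≋-trans (extend-pointwise p (λ u → ≋-trans (extend-word (λ v → word (u ++ v)) [])
                                                (≡⇒≋ (cong word (List.++-identityʳ u)))))
           (extend-unit p))

bilinear : (Word → Word → H) → H → H → H
bilinear G p q = extend (λ u → extend (G u) q) p

extend-prefix : ∀ g a p → extend g (word (a ∷ []) · p) ≋ extend (λ u → g (a ∷ u)) p
extend-prefix g a p = ≋-trans (extend-cong g (word·-as-prefix (a ∷ []) p))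
  (≋-trans (extend-extend g (λ v → word (a ∷ v)) p) (extend-pointwise p (λ v → extend-word g (a ∷ v))))

bilinear-pointwise : ∀ {G G'} p q → (∀ u v → G u v ≋ G' u v) → bilinear G p q ≋ bilinear G' p q
bilinear-pointwise p q h = extend-pointwise p (λ u → extend-pointwise q (h u))

bilinear-congʳ : ∀ G {p p'} q → p ≋ p' → bilinear G p q ≋ bilinear G p' q
bilinear-congʳ G q = extend-cong _

bilinear-congˡ : ∀ G p {q q'} → q ≋ q' → bilinear G p q ≋ bilinear G p q'
bilinear-congˡ G p e = extend-pointwise p (λ u → extend-cong _ e)

bilinear-prefixˡ : ∀ G a p q → bilinear G (word (a ∷ []) · p) q ≋ bilinear (λ u → G (a ∷ u)) p q
bilinear-prefixˡ G a p q = extend-prefix (λ u → extend (G u) q) a p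

bilinear-prefixʳ : ∀ G a p q → bilinear G p (word (a ∷ []) · q) ≋ bilinear (λ u v → G u (a ∷ v)) p q
bilinear-prefixʳ G a p q = extend-pointwise p (λ u → extend-prefix (G u) a q)

bilinear-⊕ᶠ : ∀ G G' p q → bilinear (λ u v → G u v ⊕ G' u v) p q ≋ bilinear G p q ⊕ bilinear G' p q
bilinear-⊕ᶠ G G' p q = ≋-trans (extend-pointwise p (λ u → extend-⊕ᶠ (G u) (G' u) q)) (extend-⊕ᶠ _ _ p)

·-bilinear : ∀ r G p q → r · bilinear G p q ≋ bilinear (λ u v → r · G u v) p q
·-bilinear r G p q = ≋-trans (·-extend r _ p) (extend-pointwise p (λ u → ·-extend r (G u) q))

bilinear-scaleˡ : ∀ G c p q → bilinear G (scale c p) q ≋ scale c (bilinear G p q)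
bilinear-scaleˡ G c p q = extend-scale _ c p

bilinear-scaleʳ : ∀ G c p q → bilinear G p (scale c q) ≋ scale c (bilinear G p q)
bilinear-scaleʳ G c p q = ≋-trans (extend-pointwise p (λ u → extend-scale (G u) c q)) (extend-scaleᶠ _ c p)

bilinear-distribˡ-⊕ : ∀ G p q r → bilinear G p (q ⊕ r) ≋ bilinear G p q ⊕ bilinear G p r
bilinear-distribˡ-⊕ G p q r =
  ≋-trans (extend-pointwise p (λ u → ≡⇒≋ (extend-++ (G u) q r))) (extend-⊕ᶠ _ _ p)

*-singleton : ∀ c u q → ((c , u) ∷ []) * q ≋ scale c (extend (hw u) q)
*-singleton c u [] = ≋-refl
*-singleton c u ((d , v) ∷ q) =
  ≋-trans (≡⇒≋ (List.++-assoc (scale (c *ℚ d) (hw u v)) _ []))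
  (≋-trans (⊕-cong (≋-sym (scale-scale c d (hw u v))) (*-singleton c u q))
           (≡⇒≋ (sym (scale-++ c (scale d (hw u v)) _))))

*-as-bilinear : ∀ p q → p * q ≋ bilinear hw p q
*-as-bilinear [] q = ≋-refl
*-as-bilinear ((c , u) ∷ p) q =
  ≋-trans (≡⇒≋ (cong (_++ (p * q)) (sym (List.++-identityʳ _))))
          (⊕-cong (*-singleton c u q) (*-as-bilinear p q))

*-congʳ : ∀ {p p'} q → p ≋ p' → p * q ≋ p' * q
*-congʳ {p} {p'} q e =
  ≋-trans (*-as-bilinear p q) (≋-trans (bilinear-congʳ hw q e) (≋-sym (*-as-bilinear p' q)))

*-congˡ : ∀ p {q q'} → q ≋ q' → p * q ≋ p * q'
*-congˡ p {q} {q'} e =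
  ≋-trans (*-as-bilinear p q) (≋-trans (bilinear-congˡ hw p e) (≋-sym (*-as-bilinear p q')))

*-scaleˡ : ∀ c p q → scale c p * q ≋ scale c (p * q)
*-scaleˡ c p q = ≋-trans (*-as-bilinear (scale c p) q)
  (≋-trans (bilinear-scaleˡ hw c p q) (scale-cong c (≋-sym (*-as-bilinear p q))))

*-scaleʳ : ∀ c p q → p * scale c q ≋ scale c (p * q)
*-scaleʳ c p q = ≋-trans (*-as-bilinear p (scale c q))
  (≋-trans (bilinear-scaleʳ hw c p q) (scale-cong c (≋-sym (*-as-bilinear p q))))

*-distribˡ-⊕ : ∀ p q r → p * (q ⊕ r) ≋ p * q ⊕ p * r
*-distribˡ-⊕ p q r = ≋-trans (*-as-bilinear p (q ⊕ r)) (≋-trans (bilinear-distribˡ-⊕ hw p q r)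
  (⊕-cong (≋-sym (*-as-bilinear p q)) (≋-sym (*-as-bilinear p r))))

*-identityˡ : ∀ q → word [] * q ≋ q
*-identityˡ q = ≋-trans (*-as-bilinear (word []) q)
  (≋-trans (extend-word (λ u → extend (hw u) q) []) (extend-unit q))

hw-x∷ : ∀ u v → hw u (x ∷ v) ≋ xH · hw u v
hw-x∷ [] v = word-++ (x ∷ []) v
hw-x∷ (x ∷ u) v = ·-congˡ xH (hw-x∷ u v)
hw-x∷ (y ∷ u) v = ≋-refl

*-x· : ∀ p q → p * (xH · q) ≋ xH · (p * q)
*-x· p q = begin
  p * (xH · q)                           ≈⟨ *-as-bilinear p (xH · q) ⟩
  bilinear hw p (xH · q)                 ≈⟨ bilinear-prefixʳ hw x p q ⟩
  bilinear (λ u v → hw u (x ∷ v)) p q    ≈⟨ bilinear-pointwise p q hw-x∷ ⟩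
  bilinear (λ u v → xH · hw u v) p q     ≈⟨ ·-bilinear xH hw p q ⟨
  xH · bilinear hw p q                   ≈⟨ ·-congˡ xH (*-as-bilinear p q) ⟨
  xH · (p * q)                           ∎
  where open ≋-Reasoning

y·*y· : ∀ p q →
  (yH · p) * (yH · q) ≋ yH · (p * (yH · q)) ⊕ yH · ((yH · p) * q) ⊕ word (y ∷ x ∷ []) · (p * q)
y·*y· p q = begin
  (yH · p) * (yH · q)
    ≈⟨ *-as-bilinear (yH · p) (yH · q) ⟩
  bilinear hw (yH · p) (yH · q)
    ≈⟨ bilinear-prefixˡ hw y p (yH · q) ⟩
  bilinear (λ u → hw (y ∷ u)) p (yH · q)
    ≈⟨ bilinear-prefixʳ (λ u → hw (y ∷ u)) y p q ⟩
  bilinear (λ u v → yH · hw u (y ∷ v) ⊕ yH · hw (y ∷ u) v ⊕ yxH · hw u v) p q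
    ≈⟨ bilinear-⊕ᶠ _ _ p q ⟩
  bilinear (λ u v → yH · hw u (y ∷ v) ⊕ yH · hw (y ∷ u) v) p q
    ⊕ bilinear (λ u v → yxH · hw u v) p q
    ≈⟨ ⊕-cong (bilinear-⊕ᶠ _ _ p q) ≋-refl ⟩
  bilinear (λ u v → yH · hw u (y ∷ v)) p q ⊕ bilinear (λ u v → yH · hw (y ∷ u) v) p q
    ⊕ bilinear (λ u v → yxH · hw u v) p q
    ≈⟨ ⊕-cong (⊕-cong (by-prefix yH (≋-trans (*-as-bilinear p (yH · q)) (bilinear-prefixʳ hw y p q)))
                      (by-prefix yH (≋-trans (*-as-bilinear (yH · p) q) (bilinear-prefixˡ hw y p q))))
              (by-prefix yxH (*-as-bilinear p q)) ⟩
  yH · (p * (yH · q)) ⊕ yH · ((yH · p) * q) ⊕ yxH · (p * q)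
    ∎
  where
  open ≋-Reasoning
  yxH = word (y ∷ x ∷ [])
  by-prefix : ∀ r {G s} → s ≋ bilinear G p q → bilinear (λ u v → r · G u v) p q ≋ r · s
  by-prefix r {G} e = ≋-sym (≋-trans (·-congˡ r e) (·-bilinear r G p q))

φ≡extend : ∀ p → φ p ≡ extend φW p
φ≡extend [] = refl
φ≡extend ((c , u) ∷ p) = cong (scale c (φW u) ++_) (φ≡extend p)

φ-cong : ∀ {p q} → p ≋ q → φ p ≋ φ q
φ-cong {p} {q} e = ≋-trans (≡⇒≋ (φ≡extend p)) (≋-trans (extend-cong φW e) (≡⇒≋ (sym (φ≡extend q))))

φ-⊕ : ∀ p q → φ (p ⊕ q) ≋ φ p ⊕ φ q
φ-⊕ p q = ≋-trans (≡⇒≋ (φ≡extend (p ⊕ q))) (≋-trans (≡⇒≋ (extend-++ φW p q))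
  (⊕-cong (≡⇒≋ (sym (φ≡extend p))) (≡⇒≋ (sym (φ≡extend q)))))

φ-scale : ∀ c p → φ (scale c p) ≋ scale c (φ p)
φ-scale c p = ≋-trans (≡⇒≋ (φ≡extend (scale c p)))
  (≋-trans (extend-scale φW c p) (scale-cong c (≡⇒≋ (sym (φ≡extend p)))))

φ-letter· : ∀ a q → φ (word (a ∷ []) · q) ≋ φL a · φ q
φ-letter· a q = ≋-trans (≡⇒≋ (φ≡extend (word (a ∷ []) · q))) (≋-trans (extend-prefix φW a q)
  (≋-trans (≋-sym (·-extend (φL a) φW q)) (·-congˡ (φL a) (≡⇒≋ (sym (φ≡extend q))))))

φ-x· : ∀ q → φ (xH · q) ≋ xH · φ q ⊕ yH · φ q
φ-x· q = ≋-trans (φ-letter· x q) (·-distribʳ-⊕ xH yH (φ q))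

φ-y· : ∀ q → φ (yH · q) ≋ scale -1ℚ (yH · φ q)
φ-y· q = ≋-trans (φ-letter· y q) (·-scaleˡ -1ℚ yH (φ q))

φ-word : ∀ u → φ (word u) ≋ φW u
φ-word u = ≋-trans (≡⇒≋ (φ≡extend (word u))) (extend-word φW u)

neg-involutive : ∀ p → scale -1ℚ (scale -1ℚ p) ≋ p
neg-involutive p = coeffᴱ-≋ (negᴱ (negᴱ (atom p))) (atom p)
  (λ u → solve 1 (λ a → :- (:- a) := a) refl (coeff p u))

φ-φW : ∀ u → φ (φW u) ≋ word u
φ-φW [] = φ-word []
φ-φW (x ∷ u) = begin
  φ ((xH ⊕ yH) · φW u)
    ≈⟨ φ-cong (·-distribʳ-⊕ xH yH (φW u)) ⟩
  φ (xH · φW u ⊕ yH · φW u)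
    ≈⟨ φ-⊕ (xH · φW u) (yH · φW u) ⟩
  φ (xH · φW u) ⊕ φ (yH · φW u)
    ≈⟨ ⊕-cong (φ-x· (φW u)) (φ-y· (φW u)) ⟩
  (xH · φ (φW u) ⊕ yH · φ (φW u)) ⊕ scale -1ℚ (yH · φ (φW u))
    ≈⟨ ⊕-cong (⊕-cong (·-congˡ xH (φ-φW u)) (·-congˡ yH (φ-φW u)))
              (scale-cong -1ℚ (·-congˡ yH (φ-φW u))) ⟩
  (xH · word u ⊕ yH · word u) ⊕ scale -1ℚ (yH · word u)
    ≈⟨ coeffᴱ-≋ (atom (xH · word u) ⊞ atom (yH · word u) ⊞ negᴱ (atom (yH · word u)))
                (atom (xH · word u))
         (λ v → solve 2 (λ a b → a :+ b :- b := a) refl (coeff (xH · word u) v) (coeff (yH · word u) v)) ⟩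
  xH · word u
    ≈⟨ word-++ (x ∷ []) u ⟨
  word (x ∷ u) ∎
  where open ≋-Reasoning
φ-φW (y ∷ u) = begin
  φ (scale -1ℚ yH · φW u)
    ≈⟨ φ-cong (·-scaleˡ -1ℚ yH (φW u)) ⟩
  φ (scale -1ℚ (yH · φW u))
    ≈⟨ φ-scale -1ℚ (yH · φW u) ⟩
  scale -1ℚ (φ (yH · φW u))
    ≈⟨ scale-cong -1ℚ (≋-trans (φ-y· (φW u)) (scale-cong -1ℚ (·-congˡ yH (φ-φW u)))) ⟩
  scale -1ℚ (scale -1ℚ (yH · word u))
    ≈⟨ neg-involutive (yH · word u) ⟩
  yH · word u
    ≈⟨ word-++ (y ∷ []) u ⟨
  word (y ∷ u) ∎
  where open ≋-Reasoning

φ-involutive : ∀ p → φ (φ p) ≋ p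
φ-involutive p = begin
  φ (φ p)
    ≡⟨ trans (φ≡extend (φ p)) (cong (extend φW) (φ≡extend p)) ⟩
  extend φW (extend φW p)
    ≈⟨ extend-extend φW φW p ⟩
  extend (λ u → extend φW (φW u)) p
    ≈⟨ extend-pointwise p (λ u → ≋-trans (≡⇒≋ (sym (φ≡extend (φW u)))) (φ-φW u)) ⟩
  extend word p
    ≈⟨ extend-unit p ⟩
  p ∎
  where open ≋-Reasoning

◇-congˡ : ∀ p {q q'} → q ≋ q' → p ◇ q ≋ p ◇ q'
◇-congˡ p e = φ-cong (*-congˡ (φ p) (φ-cong e))

◇-congʳ : ∀ {p p'} q → p ≋ p' → p ◇ q ≋ p' ◇ q
◇-congʳ q e = φ-cong (*-congʳ (φ q) (φ-cong e))

◇-identityˡ : ∀ q → word [] ◇ q ≋ q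
◇-identityˡ q =
  ≋-trans (φ-cong (≋-trans (*-congʳ (φ q) (φ-word [])) (*-identityˡ (φ q)))) (φ-involutive q)

neg*neg : ∀ p q → scale -1ℚ p * scale -1ℚ q ≋ p * q
neg*neg p q = ≋-trans (*-scaleˡ -1ℚ p (scale -1ℚ q))
  (≋-trans (scale-cong -1ℚ (*-scaleʳ -1ℚ p q)) (neg-involutive (p * q)))

y·◇y· : ∀ u w → (yH · u) ◇ (yH · w) ≋ yH · ((yH · u) ◇ w) ⊖ yH · (u ◇ (xH · w))
y·◇y· u w = begin
  φ (φ (yH · u) * φ (yH · w))
    ≈⟨ φ-cong signs-cancel ⟩
  φ ((yH · U) * (yH · W))
    ≈⟨ φ-cong (y·*y· U W) ⟩
  φ (yH · (U * (yH · W)) ⊕ yH · ((yH · U) * W) ⊕ word (y ∷ x ∷ []) · (U * W))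
    ≈⟨ φ-termwise ⟩
  scale -1ℚ (yH · a) ⊕ scale -1ℚ (yH · b) ⊕ scale -1ℚ (yH · (xH · c ⊕ yH · c))
    ≈⟨ coeffᴱ-≋ (negᴱ (atom (yH · a)) ⊞ negᴱ (atom (yH · b)) ⊞ negᴱ (atom (yH · (xH · c ⊕ yH · c))))
                (negᴱ (atom (yH · b)) ⊟ (atom (yH · (xH · c ⊕ yH · c)) ⊞ atom (yH · a)))
         (λ v → solve 3 (λ a b c → :- a :+ :- b :+ :- c := :- b :- (c :+ a))
                        refl (coeff (yH · a) v) (coeff (yH · b) v) (coeff (yH · (xH · c ⊕ yH · c)) v)) ⟩
  scale -1ℚ (yH · b) ⊖ (yH · (xH · c ⊕ yH · c) ⊕ yH · a)
    ≈⟨ ⊖-cong (≋-trans (·-congˡ yH y·u◇w) (·-scaleʳ -1ℚ yH b))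
              (≋-trans (·-congˡ yH u◇x·w) (·-distribˡ-⊕ yH (xH · c ⊕ yH · c) a)) ⟨
  yH · ((yH · u) ◇ w) ⊖ yH · (u ◇ (xH · w)) ∎
  where
  open ≋-Reasoning
  U = φ u
  W = φ w
  a = φ (U * (yH · W))
  b = φ ((yH · U) * W)
  c = φ (U * W)
  signs-cancel : φ (yH · u) * φ (yH · w) ≋ (yH · U) * (yH · W)
  signs-cancel = ≋-trans (*-congʳ (φ (yH · w)) (φ-y· u))
                 (≋-trans (*-congˡ (scale -1ℚ (yH · U)) (φ-y· w)) (neg*neg (yH · U) (yH · W)))
  φ-yx· : φ (word (y ∷ x ∷ []) · (U * W)) ≋ scale -1ℚ (yH · (xH · c ⊕ yH · c))
  φ-yx· = ≋-trans (φ-cong (≋-trans (·-congʳ (U * W) (word-++ (y ∷ []) (x ∷ [])))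
                                   (·-assoc yH xH (U * W))))
          (≋-trans (φ-y· (xH · (U * W))) (scale-cong -1ℚ (·-congˡ yH (φ-x· (U * W)))))
  φ-termwise : φ (yH · (U * (yH · W)) ⊕ yH · ((yH · U) * W) ⊕ word (y ∷ x ∷ []) · (U * W))
               ≋ scale -1ℚ (yH · a) ⊕ scale -1ℚ (yH · b) ⊕ scale -1ℚ (yH · (xH · c ⊕ yH · c))
  φ-termwise = ≋-trans (φ-⊕ (yH · (U * (yH · W)) ⊕ yH · ((yH · U) * W)) _)
    (⊕-cong (≋-trans (φ-⊕ (yH · (U * (yH · W))) (yH · ((yH · U) * W)))
                     (⊕-cong (φ-y· (U * (yH · W))) (φ-y· ((yH · U) * W))))
            φ-yx·)
  y·u◇w : (yH · u) ◇ w ≋ scale -1ℚ b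
  y·u◇w = ≋-trans (φ-cong (≋-trans (*-congʳ W (φ-y· u)) (*-scaleˡ -1ℚ (yH · U) W)))
                  (φ-scale -1ℚ ((yH · U) * W))
  u◇x·w : u ◇ (xH · w) ≋ (xH · c ⊕ yH · c) ⊕ a
  u◇x·w = ≋-trans (φ-cong (≋-trans (*-congˡ U (φ-x· w)) (*-distribˡ-⊕ U (xH · W) (yH · W))))
          (≋-trans (φ-⊕ (U * (xH · W)) (U * (yH · W)))
                   (⊕-cong (≋-trans (φ-cong (*-x· U W)) (φ-x· (U * W))) ≋-refl))

yⁿ◇y· : ∀ n w → yⁿ (suc n) ◇ (yH · w) ≋ yH · (yⁿ (suc n) ◇ w) ⊖ yH · (yⁿ n ◇ (xH · w))
yⁿ◇y· n w = begin
  yⁿ (suc n) ◇ (yH · w)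
    ≈⟨ ◇-congʳ (yH · w) yⁿ-suc ⟩
  (yH · yⁿ n) ◇ (yH · w)
    ≈⟨ y·◇y· (yⁿ n) w ⟩
  yH · ((yH · yⁿ n) ◇ w) ⊖ yH · (yⁿ n ◇ (xH · w))
    ≈⟨ ⊖-cong (·-congˡ yH (◇-congʳ w yⁿ-suc)) ≋-refl ⟨
  yH · (yⁿ (suc n) ◇ w) ⊖ yH · (yⁿ n ◇ (xH · w))
    ∎
  where
  open ≋-Reasoning
  yⁿ-suc : yⁿ (suc n) ≋ yH · yⁿ n
  yⁿ-suc = word-++ (y ∷ []) (replicate n y)

f-cong : ∀ n {p q} → p ≋ q → f n p ≋ f n q
f-cong zero e = e
f-cong (suc n) e = ⊖-cong (◇-congˡ (yⁿ (suc n)) e) (·-congʳ yH (◇-congˡ (yⁿ n) e))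

f-suc-y· : ∀ n w → yH · f n (xH · w) ⊕ f (suc n) (yH · w) ≋ yH · f (suc n) w
f-suc-y· zero w = begin
  yH · (xH · w) ⊕ f 1 (yH · w)
    ≈⟨ ⊕-congˡ a₁ f₁-y· ⟩
  a₁ ⊕ ((a₂ ⊖ a₁) ⊖ a₃)
    ≈⟨ coeffᴱ-≋ (atom a₁ ⊞ ((atom a₂ ⊟ atom a₁) ⊟ atom a₃)) (atom a₂ ⊟ atom a₃)
         (λ u → solve 3 (λ a b c → a :+ ((b :- a) :- c) := b :- c)
                        refl (coeff a₁ u) (coeff a₂ u) (coeff a₃ u)) ⟩
  a₂ ⊖ a₃
    ≈⟨ ≋-trans (·-distribˡ-⊖ yH (yⁿ 1 ◇ w) ((yⁿ 0 ◇ w) · yH))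
               (⊖-congˡ a₂ (·-congˡ yH (·-congʳ yH (◇-identityˡ w)))) ⟨
  yH · f 1 w ∎
  where
  open ≋-Reasoning
  a₁ = yH · (xH · w)
  a₂ = yH · (yⁿ 1 ◇ w)
  a₃ = yH · (w · yH)
  f₁-y· : f 1 (yH · w) ≋ (a₂ ⊖ a₁) ⊖ a₃
  f₁-y· = ⊖-cong (≋-trans (yⁿ◇y· 0 w) (⊖-congˡ a₂ (·-congˡ yH (◇-identityˡ (xH · w)))))
                 (≋-trans (·-congʳ yH (◇-identityˡ (yH · w))) (·-assoc yH w yH))
f-suc-y· (suc n) w = begin
  yH · f (suc n) (xH · w) ⊕ f (2 + n) (yH · w)
    ≈⟨ ⊕-cong (·-distribˡ-⊖ yH (yⁿ (1 + n) ◇ (xH · w)) ((yⁿ n ◇ (xH · w)) · yH)) f-y· ⟩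
  (a₁ ⊖ a₂) ⊕ ((a₃ ⊖ a₁) ⊖ (a₄ ⊖ a₂))
    ≈⟨ coeffᴱ-≋ ((atom a₁ ⊟ atom a₂) ⊞ ((atom a₃ ⊟ atom a₁) ⊟ (atom a₄ ⊟ atom a₂))) (atom a₃ ⊟ atom a₄)
         (λ u → solve 4 (λ a b c d → (a :- b) :+ ((c :- a) :- (d :- b)) := c :- d)
                        refl (coeff a₁ u) (coeff a₂ u) (coeff a₃ u) (coeff a₄ u)) ⟩
  a₃ ⊖ a₄
    ≈⟨ ·-distribˡ-⊖ yH (yⁿ (2 + n) ◇ w) ((yⁿ (1 + n) ◇ w) · yH) ⟨
  yH · f (2 + n) w ∎
  where
  open ≋-Reasoning
  a₁ = yH · (yⁿ (1 + n) ◇ (xH · w))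
  a₂ = yH · ((yⁿ n ◇ (xH · w)) · yH)
  a₃ = yH · (yⁿ (2 + n) ◇ w)
  a₄ = yH · ((yⁿ (1 + n) ◇ w) · yH)
  f-y· : f (2 + n) (yH · w) ≋ (a₃ ⊖ a₁) ⊖ (a₄ ⊖ a₂)
  f-y· = ⊖-cong (yⁿ◇y· (suc n) w)
                (≋-trans (·-congʳ yH (yⁿ◇y· n w))
                (≋-trans (·-distribʳ-⊖ (yH · (yⁿ (1 + n) ◇ w)) (yH · (yⁿ n ◇ (xH · w))) yH)
                         (⊖-cong (·-assoc yH (yⁿ (1 + n) ◇ w) yH) (·-assoc yH (yⁿ n ◇ (xH · w)) yH))))

sumTo-cong : ∀ n {g h} → (∀ j → j ≤ n → g j ≋ h j) → sumTo n g ≋ sumTo n h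
sumTo-cong zero e = e zero z≤n
sumTo-cong (suc n) e = ⊕-cong (sumTo-cong n (λ j j≤n → e j (m≤n⇒m≤1+n j≤n))) (e (suc n) ≤-refl)

replicate-suc-snoc : ∀ {A : Set} k (a : A) → replicate (suc k) a ≡ replicate k a ++ a ∷ []
replicate-suc-snoc zero a = refl
replicate-suc-snoc (suc k) a = cong (a ∷_) (replicate-suc-snoc k a)

y·xⁿ·-shift : ∀ n j w → j ≤ n → yH · xⁿ (suc n ∸ j) · w ≋ yH · xⁿ (n ∸ j) · (xH · w)
y·xⁿ·-shift n j w j≤n = begin
  yH · xⁿ (suc n ∸ j) · w            ≡⟨ cong (λ k → yH · xⁿ k · w) (+-∸-assoc 1 j≤n) ⟩
  yH · xⁿ (suc (n ∸ j)) · w          ≡⟨ cong (λ u → yH · word u · w) (replicate-suc-snoc (n ∸ j) x) ⟩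
  yH · word (replicate (n ∸ j) x ++ x ∷ []) · w
                                     ≈⟨ ·-congʳ w (·-congˡ yH (word-++ (replicate (n ∸ j) x) (x ∷ []))) ⟩
  yH · (xⁿ (n ∸ j) · xH) · w         ≈⟨ ·-congʳ w (·-assoc yH (xⁿ (n ∸ j)) xH) ⟨
  yH · xⁿ (n ∸ j) · xH · w           ≈⟨ ·-assoc (yH · xⁿ (n ∸ j)) xH w ⟩
  yH · xⁿ (n ∸ j) · (xH · w)         ∎
  where open ≋-Reasoning

y·xⁿ⁻ⁿ· : ∀ n w → yH · xⁿ (n ∸ n) · w ≋ yH · w
y·xⁿ⁻ⁿ· n w =
  ≋-trans (≡⇒≋ (cong (λ k → yH · xⁿ k · w) (n∸n≡0 n))) (·-congʳ w (·-identityʳ yH))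

lemma5p2 : (n : ℕ) (w : H) →
    sumTo n (λ j → f j (yH · xⁿ (n ∸ j) · w)) ≈ yH · f n w
lemma5p2 zero w = ≋⇒≈ (·-congʳ w (·-identityʳ yH))
lemma5p2 (suc n) w = ≋⇒≈ (begin
  sumTo (suc n) (λ j → f j (yH · xⁿ (suc n ∸ j) · w))
    ≈⟨ ⊕-cong (sumTo-cong n (λ j j≤n → f-cong j (y·xⁿ·-shift n j w j≤n)))
              (f-cong (suc n) (y·xⁿ⁻ⁿ· n w)) ⟩
  sumTo n (λ j → f j (yH · xⁿ (n ∸ j) · (xH · w))) ⊕ f (suc n) (yH · w)
    ≈⟨ ⊕-cong induction-hypothesis ≋-refl ⟩
  yH · f n (xH · w) ⊕ f (suc n) (yH · w)
    ≈⟨ f-suc-y· n w ⟩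
  yH · f (suc n) w ∎)
  where
  open ≋-Reasoning
  induction-hypothesis : sumTo n (λ j → f j (yH · xⁿ (n ∸ j) · (xH · w))) ≋ yH · f n (xH · w)
  induction-hypothesis = ≈⇒≋ (lemma5p2 n (xH · w))
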